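{- Let $A$ and $B$ be asynchronously composable IOTSes. (1) If $A$ and $B$ are strongly asynchronously compatible, then $A$ and $B$ are strongly synchronously compatible. (2) If at least one of the following conditions holds: (a) $A\otimes_{as}B$ satisfies property $\mathcal{P}$; (b) $A\otimes_{as}B$ is half-duplex; (c) for each $(s_A,s_B)\in\mathit{reach}(A\otimes B)$ and all transitions $s_A\xrightarrow{a}_A s_A'$, $s_B\xrightarrow{b}_B s_B'$, either $a\notin\mathit{out}_A\cap\mathit{in}_B$ or $b\notin\mathit{out}_B\cap\mathit{in}_A$ — then, if $A$ and $B$ are weakly asynchronously compatible, they are weakly synchronously compatible.
   Context: An IOTS $A=(\mathit{states}_A,\mathit{start}_A,\mathit{act}_A,\to_A)$ has states, initial state, actions $\mathit{act}_A=\mathit{in}_A\cup\mathit{out}_A\cup\mathit{int}_A$ (disjoint union of inputs, outputs, internal actions) and transitions $s\xrightarrow{a}_A s'$. $s\ (\xrightarrow{X})^*_A\ s'$ denotes a possibly empty finite sequence of transitions labelled in $X$; $\mathit{reach}(A)$ is the set of states reachable from $\mathit{start}_A$. $A,B$ are composable if $\mathit{act}_A\cap\mathit{act}_B=(\mathit{in}_A\cap\mathit{out}_B)\cup(\mathit{in}_B\cap\mathit{out}_A)=:\mathit{shared}(A,B)$. Synchronous composition $A\otimes B$: states $\mathit{states}_A\times\mathit{states}_B$, initial $(\mathit{start}_A,\mathit{start}_B)$, inputs $(\mathit{in}_A\cup\mathit{in}_B)\setminus\mathit{shared}(A,B)$, outputs $(\mathit{out}_A\cup\mathit{out}_B)\setminus\mathit{shared}(A,B)$,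 internal $\mathit{int}_A\cup\mathit{int}_B\cup\mathit{shared}(A,B)$; a non-shared action of one component moves only that component; a shared action $a$ yields $(s,t)\xrightarrow{a}(s',t')$ when $s\xrightarrow{a}_A s'$ and $t\xrightarrow{a}_B t'$. For a set $M$, $M^\rhd=\{a^\rhd\mid a\in M\}$ are fresh names. $A,B$ are asynchronously composable if composable and $\mathit{shared}(A,B)^\rhd\cap(\mathit{act}_A\cup\mathit{act}_B)=\emptyset$. With $\mathit{out}_{AB}=\mathit{out}_A\cap\mathit{in}_B$, $\Omega(A)$ is the IOTS with states $(s,q)$, $s\in\mathit{states}_A$, $q\in\mathit{out}_{AB}^*$, initial $(\mathit{start}_A,\epsilon)$, inputs $\mathit{in}_A$, outputs $\mathit{out}_A$, internal actions $\mathit{int}_A\cup\mathit{out}_{AB}^\rhd$, transitions $(s,q)\xrightarrow{a}(s',q)$ if $s\xrightarrow{a}_A s'$, $a\notin\mathit{out}_{AB}$; $(s,q)\xrightarrow{a^\rhd}(s',qa)$ if $s\xrightarrow{a}_A s'$, $a\in\mathit{out}_{AB}$; $(s,aq)\xrightarrow{a}(s,q)$ for $a\in\mathit{out}_{AB}$. $\Omega(B)$ analogously with $\mathit{out}_{BA}=\mathit{out}_B\cap\mathit{in}_A$. $A\otimes_{as}B=\Omega(A)\otimes\Omega(B)$, with states $((s_A,q_A),(s_B,q_B))$ and initial state $((\mathit{start}_A,\epsilon),(\mathit{start}_B,\epsilon))$. $A,B$ are strongly synchronously compatible if composable and for all $(s_A,s_B)\in\mathit{reach}(A\otimes B)$ and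 $a\in\mathit{out}_A\cap\mathit{in}_B$: if $s_A\xrightarrow{a}_A s_A'$ for some $s_A'$ then $s_B\xrightarrow{a}_B s_B'$ for some $s_B'$; and symmetrically for $b\in\mathit{out}_B\cap\mathit{in}_A$. Weakly synchronously compatible: same but with the conclusion $s_B\ (\xrightarrow{\mathit{int}_B})^*_B\ \bar s_B\xrightarrow{a}_B s_B'$ for some $\bar s_B,s_B'$ (symmetrically with $\mathit{int}_A$). Asynchronously composable $A,B$ are strongly (weakly) asynchronously compatible if $\Omega(A)$ and $\Omega(B)$ are strongly (weakly) synchronously compatible. $A\otimes_{as}B$ is half-duplex if each reachable state $((s_A,q_A),(s_B,q_B))$ of $\Omega(A)\otimes\Omega(B)$ has $q_A=\epsilon$ or $q_B=\epsilon$. Property $\mathcal{P}$: with $F_A=\mathit{act}_A\setminus\mathit{shared}(A,B)$, for $a\in\mathit{out}_A\cap\mathit{in}_B$ write $s\Rightarrow^a_A s'$ if $s\ (\xrightarrow{F_A})^*_A\ \bar s\xrightarrow{a}_A\bar s'\ (\xrightarrow{F_A})^*_A\ s'$ for some $\bar s,\bar s'$; $\Rightarrow^b_B$ analogously with $F_B=\mathit{act}_B\setminus\mathit{shared}(A,B)$. $A\otimes_{as}B$ satisfies $\mathcal{P}$ if every reachable state $((s_A,q_A),(s_B,q_B))$ satisfies one of: (i) $q_A=q_B=\epsilon$ and $(s_A,s_B)\in\mathit{reach}(A\otimes B)$; (ii) $q_A=a_1\ldots a_m\neq\epsilon$, $q_B=\epsilon$, and some $r_A$ has $(r_A,s_B)\in\mathit{reach}(A\otimes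 B)$ and $r_A\Rightarrow^{a_1}_A\cdots\Rightarrow^{a_m}_A s_A$; (iii) $q_A=\epsilon$, $q_B=b_1\ldots b_m\neq\epsilon$, and some $r_B$ has $(s_A,r_B)\in\mathit{reach}(A\otimes B)$ and $r_B\Rightarrow^{b_1}_B\cdots\Rightarrow^{b_m}_B s_B$. -}

module Defs where

open import Data.Product using (Σ; ∃; ∃-syntax; _×_; _,_)
open import Data.Sum using (_⊎_; inj₁; inj₂)
open import Data.Empty using (⊥)
open import Data.Unit using (⊤)
open import Data.List using (List; []; _∷_; _∷ʳ_)
open import Relation.Nullary using (¬_)
open import Relation.Binary.PropositionalEquality using (_≡_)

record IOTS (X : Set) : Set₁ where
  field
    State : Set
    start : State
    In    : X → Set
    Out   : X → Set
    Int   : X → Set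
    Step  : State → X → State → Set

open IOTS public

Act : ∀ {X} → IOTS X → X → Set
Act A a = In A a ⊎ Out A a ⊎ Int A a

record IsIOTS {X : Set} (A : IOTS X) : Set where
  field
    in-out  : ∀ a → In A a → Out A a → ⊥
    in-int  : ∀ a → In A a → Int A a → ⊥
    out-int : ∀ a → Out A a → Int A a → ⊥
    labels  : ∀ {s a s'} → Step A s a s' → Act A a

data Steps {X : Set} (A : IOTS X) (P : X → Set) : State A → State A → Set where
  done : ∀ {s} → Steps A P s s
  step : ∀ {s a s' s''} → P a → Step A s a s' → Steps A P s' s'' → Steps A P s s''

Reach : ∀ {X} → (A : IOTS X) → State A → Set
Reach A s = Steps A (λ _ → ⊤) (start A) s

Shared : ∀ {X} → IOTS X → IOTS X → X → Set
Shared A B a = (In A a × Out B a) ⊎ (In B a × Out A a)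

-- act_A ∩ act_B = shared(A,B)   (the inclusion ⊇ is automatic)
Composable : ∀ {X} → IOTS X → IOTS X → Set
Composable A B = ∀ a → Act A a → Act B a → Shared A B a

data SyncStep {X : Set} (A B : IOTS X) : State A × State B → X → State A × State B → Set where
  left  : ∀ {s s' t a} → ¬ Shared A B a → Step A s a s' → SyncStep A B (s , t) a (s' , t)
  right : ∀ {s t t' a} → ¬ Shared A B a → Step B t a t' → SyncStep A B (s , t) a (s , t')
  both  : ∀ {s s' t t' a} → Shared A B a → Step A s a s' → Step B t a t' →
          SyncStep A B (s , t) a (s' , t')

_⊗_ : ∀ {X} → IOTS X → IOTS X → IOTS X
A ⊗ B = record
  { State = State A × State B
  ; start = start A , start B
  ; In    = λ a → (In A a ⊎ In B a) × ¬ Shared A B a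
  ; Out   = λ a → (Out A a ⊎ Out B a) × ¬ Shared A B a
  ; Int   = λ a → Int A a ⊎ Int B a ⊎ Shared A B a
  ; Step  = SyncStep A B
  }

StronglySyncCompatible : ∀ {Y} → IOTS Y → IOTS Y → Set
StronglySyncCompatible A B =
  Composable A B ×
  (∀ sA sB → Reach (A ⊗ B) (sA , sB) →
     (∀ a → Out A a → In B a → ∀ sA' → Step A sA a sA' →
        ∃[ sB' ] Step B sB a sB') ×
     (∀ b → Out B b → In A b → ∀ sB' → Step B sB b sB' →
        ∃[ sA' ] Step A sA b sA'))

WeaklySyncCompatible : ∀ {Y} → IOTS Y → IOTS Y → Set
WeaklySyncCompatible A B =
  Composable A B ×
  (∀ sA sB → Reach (A ⊗ B) (sA , sB) →
     (∀ a → Out A a → In B a → ∀ sA' → Step A sA a sA' →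
        ∃[ s̄B ] ∃[ sB' ] (Steps B (Int B) sB s̄B × Step B s̄B a sB')) ×
     (∀ b → Out B b → In A b → ∀ sB' → Step B sB b sB' →
        ∃[ s̄A ] ∃[ sA' ] (Steps A (Int A) sA s̄A × Step A s̄A b sA')))

-- Asynchronous composition.
-- Actions of Ω(A) live in X ⊎ X:  inj₁ a  is the action a,  inj₂ a  is the
-- fresh name a^▷.  Freshness of the names a^▷ is thus built in.

OutTo : ∀ {X} → IOTS X → IOTS X → X → Set
OutTo A B a = Out A a × In B a

OnlyL : ∀ {X : Set} → (X → Set) → X ⊎ X → Set
OnlyL P (inj₁ a) = P a
OnlyL P (inj₂ a) = ⊥

data ΩStep {X : Set} (A B : IOTS X) : State A × List X → X ⊎ X → State A × List X → Set where
  plain : ∀ {s s' q a} → ¬ OutTo A B a → Step A s a s' → ΩStep A B (s , q) (inj₁ a) (s' , q)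
  send  : ∀ {s s' q a} → OutTo A B a → Step A s a s' → ΩStep A B (s , q) (inj₂ a) (s' , q ∷ʳ a)
  deliver : ∀ {s q a} → OutTo A B a → ΩStep A B (s , a ∷ q) (inj₁ a) (s , q)

-- Ω(A) taken relative to the partner B (so that out_AB = out_A ∩ in_B);
-- Ω(B) is  Ω B A.
Ω : ∀ {X} → IOTS X → IOTS X → IOTS (X ⊎ X)
Ω {X} A B = record
  { State = State A × List X
  ; start = start A , []
  ; In    = OnlyL (In A)
  ; Out   = OnlyL (Out A)
  ; Int   = λ { (inj₁ a) → Int A a ; (inj₂ a) → OutTo A B a }
  ; Step  = ΩStep A B
  }

_⊗as_ : ∀ {X} → IOTS X → IOTS X → IOTS (X ⊎ X)
A ⊗as B = Ω A B ⊗ Ω B A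

-- Asynchronously composable: composable and shared(A,B)^▷ disjoint from
-- act_A ∪ act_B.  The second condition holds by construction (fresh names
-- are tagged with inj₂), so only composability remains.
AsyncComposable : ∀ {X} → IOTS X → IOTS X → Set
AsyncComposable A B = Composable A B

StronglyAsyncCompatible : ∀ {X} → IOTS X → IOTS X → Set
StronglyAsyncCompatible A B =
  AsyncComposable A B × StronglySyncCompatible (Ω A B) (Ω B A)

WeaklyAsyncCompatible : ∀ {X} → IOTS X → IOTS X → Set
WeaklyAsyncCompatible A B =
  AsyncComposable A B × WeaklySyncCompatible (Ω A B) (Ω B A)

HalfDuplex : ∀ {X} → IOTS X → IOTS X → Set
HalfDuplex {X} A B =
  ∀ sA (qA : List X) sB (qB : List X) → Reach (A ⊗as B) ((sA , qA) , (sB , qB)) →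
  (qA ≡ []) ⊎ (qB ≡ [])

Free : ∀ {X} → IOTS X → IOTS X → X → Set
Free A B a = Act A a × ¬ Shared A B a

WeakStep : ∀ {X} → (A B : IOTS X) → State A → X → State A → Set
WeakStep A B s a s' =
  ∃[ s̄ ] ∃[ s̄' ] (Steps A (Free A B) s s̄ × Step A s̄ a s̄' × Steps A (Free A B) s̄' s')

data WeakSteps {X : Set} (A B : IOTS X) : State A → List X → State A → Set where
  []  : ∀ {r} → WeakSteps A B r [] r
  _∷_ : ∀ {r r' s a w} → WeakStep A B r a r' → WeakSteps A B r' w s →
        WeakSteps A B r (a ∷ w) s

data NonEmpty {X : Set} : List X → Set where
  nonEmpty : ∀ {a w} → NonEmpty (a ∷ w)

PropertyP : ∀ {X} → IOTS X → IOTS X → Set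
PropertyP {X} A B =
  ∀ sA (qA : List X) sB (qB : List X) → Reach (A ⊗as B) ((sA , qA) , (sB , qB)) →
    (qA ≡ [] × qB ≡ [] × Reach (A ⊗ B) (sA , sB))
  ⊎
    (NonEmpty qA × qB ≡ [] ×
      ∃[ rA ] (Reach (A ⊗ B) (rA , sB) × WeakSteps A B rA qA sA))
  ⊎
    (qA ≡ [] × NonEmpty qB ×
      ∃[ rB ] (Reach (A ⊗ B) (sA , rB) × WeakSteps B A rB qB sB))

ConditionC : ∀ {X} → IOTS X → IOTS X → Set
ConditionC A B =
  ∀ sA sB → Reach (A ⊗ B) (sA , sB) →
  ∀ a sA' b sB' → Step A sA a sA' → Step B sB b sB' →
  (¬ (Out A a × In B a)) ⊎ (¬ (Out B b × In A b))

-- A synchronous run of A ⊗ B is replayed by A ⊗as B with empty queues, a shared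
-- action becoming a send followed by its delivery.  If A can output a to B at a
-- reachable state, A ⊗as B can reach the state where a sits alone in A's queue;
-- asynchronous compatibility then lets Ω(B) receive a from its empty queue.  In
-- the strong case this is a single step of B.  In the weak case Ω(B) may first
-- move internally, and those moves are moves of B unless B sends to A on the way;
-- half-duplexness (which property P implies) or condition (c) rules that out.
module Submission where

open import Defs
open import Data.Product using (_×_; _,_; proj₁; ∃-syntax)
import Data.Product as Product
open import Data.Sum using (_⊎_; inj₁; inj₂; [_,_])
import Data.Sum as Sum
open import Data.Empty using (⊥; ⊥-elim)
open import Data.Unit using (⊤; tt)
open import Data.List using ([]; _∷_; _∷ʳ_)
open import Function using (_∘_; id)
open import Relation.Nullary using (¬_)
open import Relation.Binary.PropositionalEquality using (_≡_; refl)

private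
  variable
    X : Set
    A B : IOTS X

_◅◅_ : ∀ {P : X → Set} {s s' s''} → Steps A P s s' → Steps A P s' s'' → Steps A P s s''
done ◅◅ r' = r'
step p st r ◅◅ r' = step p st (r ◅◅ r')

_▻_ : ∀ {s s' a s''} → Steps A (λ _ → ⊤) s s' → Step A s' a s'' → Steps A (λ _ → ⊤) s s''
r ▻ st = r ◅◅ step tt st done

Composable-sym : Composable A B → Composable B A
Composable-sym c a inB inA = Sum.swap (c a inA inB)

⊗-swap : ∀ {P : X → Set} {s t s' t'} →
  Steps (A ⊗ B) P (s , t) (s' , t') → Steps (B ⊗ A) P (t , s) (t' , s')
⊗-swap done = done
⊗-swap (step p (left ns st) r) = step p (right (ns ∘ Sum.swap) st) (⊗-swap r)
⊗-swap (step p (right ns st) r) = step p (left (ns ∘ Sum.swap) st) (⊗-swap r)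
⊗-swap (step p (both sh stA stB) r) = step p (both (Sum.swap sh) stB stA) (⊗-swap r)

⊗-right : ∀ {P : X → Set} {s t t'} → (∀ {x} → P x → ¬ Shared A B x) →
  Steps B P t t' → Steps (A ⊗ B) (λ _ → ⊤) (s , t) (s , t')
⊗-right unshared done = done
⊗-right unshared (step p st r) = step tt (right (unshared p) st) (⊗-right unshared r)

Receptiveness : Set₁
Receptiveness = ∀ {Y} → (A B : IOTS Y) → State A → State B → Set

StronglyReceptive : Receptiveness
StronglyReceptive A B sA sB =
  ∀ a → Out A a → In B a → ∀ sA' → Step A sA a sA' → ∃[ sB' ] Step B sB a sB'

WeaklyReceptive : Receptiveness
WeaklyReceptive A B sA sB =
  ∀ a → Out A a → In B a → ∀ sA' → Step A sA a sA' →
  ∃[ s̄B ] ∃[ sB' ] (Steps B (Int B) sB s̄B × Step B s̄B a sB')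

AlwaysReceptive : Receptiveness → (A B : IOTS X) → Set
AlwaysReceptive R A B = ∀ {sA sB} → Reach (A ⊗ B) (sA , sB) → R A B sA sB

-- StronglySyncCompatible and WeaklySyncCompatible are definitionally
-- SyncCompatible StronglyReceptive and SyncCompatible WeaklyReceptive.
SyncCompatible : Receptiveness → (A B : IOTS X) → Set
SyncCompatible R A B =
  Composable A B × (∀ sA sB → Reach (A ⊗ B) (sA , sB) → R A B sA sB × R B A sB sA)

SyncCompatible-intro : ∀ (R : Receptiveness) →
  Composable A B → AlwaysReceptive R A B → AlwaysReceptive R B A → SyncCompatible R A B
SyncCompatible-intro R c recA recB = c , λ _ _ r → recA r , recB (⊗-swap r)

SyncCompatible-sym : ∀ (R : Receptiveness) → SyncCompatible R A B → SyncCompatible R B A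
SyncCompatible-sym {A = A} {B} R (c , rec) =
  Composable-sym {A = A} {B} c , λ sB sA r → Product.swap (rec sA sB (⊗-swap r))

StronglyAsyncCompatible-sym : StronglyAsyncCompatible A B → StronglyAsyncCompatible B A
StronglyAsyncCompatible-sym {A = A} {B} (c , h) =
  Composable-sym {A = A} {B} c , SyncCompatible-sym StronglyReceptive h

WeaklyAsyncCompatible-sym : WeaklyAsyncCompatible A B → WeaklyAsyncCompatible B A
WeaklyAsyncCompatible-sym {A = A} {B} (c , h) =
  Composable-sym {A = A} {B} c , SyncCompatible-sym WeaklyReceptive h

CannotSendTo : (B A : IOTS X) → State B → Set
CannotSendTo B A t₀ = ∀ {t b t'} → Steps B (Int B) t₀ t → OutTo B A b → Step B t b t' → ⊥

NoCrossingOutputs : (A B : IOTS X) → Set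
NoCrossingOutputs A B = ∀ {sA sB a sA'} →
  Reach (A ⊗ B) (sA , sB) → OutTo A B a → Step A sA a sA' → CannotSendTo B A sB

PropertyP⇒HalfDuplex : PropertyP A B → HalfDuplex A B
PropertyP⇒HalfDuplex P sA qA sB qB r with P sA qA sB qB r
... | inj₁ (qA≡[] , _) = inj₁ qA≡[]
... | inj₂ (inj₁ (_ , qB≡[] , _)) = inj₂ qB≡[]
... | inj₂ (inj₂ (qA≡[] , _)) = inj₁ qA≡[]

HalfDuplex-sym : HalfDuplex A B → HalfDuplex B A
HalfDuplex-sym hd sB qB sA qA r = Sum.swap (hd sA qA sB qB (⊗-swap r))

ConditionC-sym : ConditionC A B → ConditionC B A
ConditionC-sym C sB sA r b sB' a sA' stB stA =
  Sum.swap (C sA sB (⊗-swap r) a sA' b sB' stA stB)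

module _ {A B : IOTS X} (iA : IsIOTS A) (iB : IsIOTS B) where

  Int-unshared : ∀ {x} → Int B x → ¬ Shared A B x
  Int-unshared ix (inj₁ (_ , outB)) = IsIOTS.out-int iB _ outB ix
  Int-unshared ix (inj₂ (inB , _)) = IsIOTS.in-int iB _ inB ix

  fresh-unshared : ∀ {x} → ¬ Shared (Ω A B) (Ω B A) (inj₂ x)
  fresh-unshared (inj₁ (() , _))
  fresh-unshared (inj₂ (() , _))

  Ω-Int-unshared : ∀ {y} → Int (Ω B A) y → ¬ Shared (Ω A B) (Ω B A) y
  Ω-Int-unshared {inj₁ _} = Int-unshared
  Ω-Int-unshared {inj₂ x} _ = fresh-unshared {x}

  Ω-internal : ∀ {t t' q} →
    Steps B (Int B) t t' → Steps (Ω B A) (Int (Ω B A)) (t , q) (t' , q)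
  Ω-internal done = done
  Ω-internal (step ix st r) =
    step ix (plain (λ o → IsIOTS.out-int iB _ (proj₁ o) ix) st) (Ω-internal r)

  Ω-send-left : ∀ {s a s' q r} → OutTo A B a → Step A s a s' →
    Step (A ⊗as B) ((s , q) , r) (inj₂ a) ((s' , q ∷ʳ a) , r)
  Ω-send-left {a = a} o st = left (fresh-unshared {a}) (send o st)

  Ω-send-right : ∀ {t b t' q p} → OutTo B A b → Step B t b t' →
    Step (A ⊗as B) (p , (t , q)) (inj₂ b) (p , (t' , q ∷ʳ b))
  Ω-send-right {b = b} o st = right (fresh-unshared {b}) (send o st)

  Ω-step-from-empty : ∀ {t a t' q} → Step (Ω B A) (t , []) (inj₁ a) (t' , q) → Step B t a t'
  Ω-step-from-empty (plain _ st) = st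

  emptyQueues : State A × State B → State (A ⊗as B)
  emptyQueues (s , t) = (s , []) , (t , [])

  SyncStep⇒async : ∀ {p x p'} → SyncStep A B p x p' →
    Steps (A ⊗as B) (λ _ → ⊤) (emptyQueues p) (emptyQueues p')
  SyncStep⇒async (left ns st) =
    step tt (left ns (plain (ns ∘ inj₂ ∘ Product.swap) st)) done
  SyncStep⇒async (right ns st) =
    step tt (right ns (plain (ns ∘ inj₁ ∘ Product.swap) st)) done
  SyncStep⇒async (both sh@(inj₁ (inA , outB)) stA stB) =
    step tt (Ω-send-right (outB , inA) stB)
      (step tt (both sh (plain (IsIOTS.in-out iA _ inA ∘ proj₁) stA) (deliver (outB , inA))) done)
  SyncStep⇒async (both sh@(inj₂ (inB , outA)) stA stB) =
    step tt (Ω-send-left (outA , inB) stA)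
      (step tt (both sh (deliver (outA , inB)) (plain (IsIOTS.in-out iB _ inB ∘ proj₁) stB)) done)

  sync⇒async : ∀ {p p'} → Steps (A ⊗ B) (λ _ → ⊤) p p' →
    Steps (A ⊗as B) (λ _ → ⊤) (emptyQueues p) (emptyQueues p')
  sync⇒async done = done
  sync⇒async (step _ st r) = SyncStep⇒async st ◅◅ sync⇒async r

  reach-after-send : ∀ {sA sB a sA'} →
    Reach (A ⊗ B) (sA , sB) → OutTo A B a → Step A sA a sA' →
    Reach (A ⊗as B) ((sA' , a ∷ []) , (sB , []))
  reach-after-send r o st = sync⇒async r ▻ Ω-send-left o st

  StronglyAsyncCompatible⇒StronglyReceptive :
    StronglyAsyncCompatible A B → AlwaysReceptive StronglyReceptive A B
  StronglyAsyncCompatible⇒StronglyReceptive (_ , _ , H) r a outA inB sA' st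
    with proj₁ (H _ _ (reach-after-send r (outA , inB) st)) (inj₁ a) outA inB (sA' , [])
           (deliver (outA , inB))
  ... | (sB' , _) , stΩ = sB' , Ω-step-from-empty stΩ

  Ω-internal-run : ∀ {t t' q} → CannotSendTo B A t →
    Steps (Ω B A) (Int (Ω B A)) (t , []) (t' , q) → Steps B (Int B) t t' × q ≡ []
  Ω-internal-run cannotSend done = done , refl
  Ω-internal-run cannotSend (step {a = inj₁ _} ix (plain _ st) r) =
    Product.map₁ (step ix st) (Ω-internal-run (λ run → cannotSend (step ix st run)) r)
  Ω-internal-run cannotSend (step {a = inj₂ _} _ (send o st) _) = ⊥-elim (cannotSend done o st)

  WeaklyAsyncCompatible⇒WeaklyReceptive :
    WeaklyAsyncCompatible A B → NoCrossingOutputs A B → AlwaysReceptive WeaklyReceptive A B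
  WeaklyAsyncCompatible⇒WeaklyReceptive (_ , _ , H) noCrossing r a outA inB sA' st
    with proj₁ (H _ _ (reach-after-send r (outA , inB) st)) (inj₁ a) outA inB (sA' , [])
           (deliver (outA , inB))
  ... | (s̄B , _) , _ , runΩ , stΩ with Ω-internal-run (noCrossing r (outA , inB) st) runΩ
  ... | runB , refl = s̄B , _ , runB , Ω-step-from-empty stΩ

  HalfDuplex⇒NoCrossingOutputs : HalfDuplex A B → NoCrossingOutputs A B
  HalfDuplex⇒NoCrossingOutputs hd r o st run o' st'
    with hd _ _ _ _ ((reach-after-send r o st
                         ◅◅ ⊗-right (λ {y} → Ω-Int-unshared {y}) (Ω-internal run))
                       ▻ Ω-send-right o' st')
  ... | inj₁ ()
  ... | inj₂ ()

  ConditionC⇒NoCrossingOutputs : ConditionC A B → NoCrossingOutputs A B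
  ConditionC⇒NoCrossingOutputs C r o st run o' st' =
    [ (λ ¬o → ¬o o) , (λ ¬o' → ¬o' o') ] (C _ _ (r ◅◅ ⊗-right Int-unshared run) _ _ _ _ st st')

  HalfDuplex⊎ConditionC⇒NoCrossingOutputs :
    HalfDuplex A B ⊎ ConditionC A B → NoCrossingOutputs A B
  HalfDuplex⊎ConditionC⇒NoCrossingOutputs =
    [ HalfDuplex⇒NoCrossingOutputs , ConditionC⇒NoCrossingOutputs ]

theorem4p9 : ∀ {X : Set} (A B : IOTS X) → IsIOTS A → IsIOTS B →
    AsyncComposable A B →
    (StronglyAsyncCompatible A B → StronglySyncCompatible A B) ×
    ((PropertyP A B ⊎ HalfDuplex A B ⊎ ConditionC A B) →
      WeaklyAsyncCompatible A B → WeaklySyncCompatible A B)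
theorem4p9 A B iA iB c = strong , weak
  where
  strong : StronglyAsyncCompatible A B → StronglySyncCompatible A B
  strong h = SyncCompatible-intro StronglyReceptive c
    (StronglyAsyncCompatible⇒StronglyReceptive iA iB h)
    (StronglyAsyncCompatible⇒StronglyReceptive iB iA (StronglyAsyncCompatible-sym h))

  weak : PropertyP A B ⊎ HalfDuplex A B ⊎ ConditionC A B →
    WeaklyAsyncCompatible A B → WeaklySyncCompatible A B
  weak cond h = SyncCompatible-intro WeaklyReceptive c
    (WeaklyAsyncCompatible⇒WeaklyReceptive iA iB h
      (HalfDuplex⊎ConditionC⇒NoCrossingOutputs iA iB hd⊎C))
    (WeaklyAsyncCompatible⇒WeaklyReceptive iB iA (WeaklyAsyncCompatible-sym h)
      (HalfDuplex⊎ConditionC⇒NoCrossingOutputs iB iA (Sum.map HalfDuplex-sym ConditionC-sym hd⊎C)))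
    where
    hd⊎C : HalfDuplex A B ⊎ ConditionC A B
    hd⊎C = [ inj₁ ∘ PropertyP⇒HalfDuplex , id ] cond
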